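{- Let $C_{P,n}$ denote the number of minimal Roman dominating functions of the path $P_n$ on $n$ vertices. Then $C_{P,n}=\mathcal{O}^*(c^n)$ for some constant $c\le 1.6852$.
   Context: For a graph $G=(V,E)$, a function $f\colon V\to\{0,1,2\}$ is a Roman dominating function (rdf) if every vertex $v$ with $f(v)=0$ has a neighbor $u$ with $f(u)=2$. Functions $V\to\{0,1,2\}$ are ordered pointwise: $f\le g$ iff $f(v)\le g(v)$ for all $v$. An rdf $f$ is minimal if there is no rdf $g\neq f$ with $g\le f$. The path $P_n$ has vertices $v_1,\dots,v_n$ and edges $v_iv_{i+1}$ for $i\in[n-1]$. The notation $\mathcal{O}^*(\cdot)$ suppresses factors polynomial in $n$. -}

module Defs where

open import Data.Nat using (ℕ; zero; suc; _≤_)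
open import Data.Fin using (Fin; toℕ)
open import Data.Vec using (Vec; lookup)
open import Data.Product using (∃; _×_)
open import Data.Sum using (_⊎_)
open import Relation.Binary.PropositionalEquality using (_≡_)

-- The path P_n: vertex set Fin n (vertex v_{i+1} is i), edges between i and i+1.
PathAdj : (n : ℕ) → Fin n → Fin n → Set
PathAdj n i j = suc (toℕ i) ≡ toℕ j ⊎ suc (toℕ j) ≡ toℕ i

Labelling : ℕ → Set
Labelling n = Vec (Fin 3) n

val : {n : ℕ} → Labelling n → Fin n → ℕ
val f v = toℕ (lookup f v)

IsRDF : (n : ℕ) → Labelling n → Set
IsRDF n f = ∀ (v : Fin n) → val f v ≡ 0 → ∃ λ (u : Fin n) → PathAdj n v u × val f u ≡ 2

_≤L_ : {n : ℕ} → Labelling n → Labelling n → Set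
f ≤L g = ∀ v → val f v ≤ val g v

IsMinimalRDF : (n : ℕ) → Labelling n → Set
IsMinimalRDF n f = IsRDF n f × (∀ (g : Labelling n) → IsRDF n g → g ≤L f → g ≡ f)

module Submission where

-- On a path, minimality of an rdf f is a local condition.  A vertex labelled 0
-- needs a neighbour labelled 2; a vertex labelled 1 has no neighbour labelled 2
-- (else lowering it to 0 gives a smaller rdf); a vertex labelled 2 has a
-- neighbour labelled 0 whose only neighbour labelled 2 it is (else lowering it
-- to 1 gives a smaller rdf).  Each condition reads five consecutive cells, so
-- the minimal rdfs of P_n are among the words of length n accepted by a finite
-- automaton remembering the last four cells.  A weight W on its states with
-- 10000 · Σ W(successors of q) ≤ 16852 · W(q) then bounds the number of
-- words of length n accepted from q by W(q) · 1.6852^n.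

open import Defs
open import Data.Nat using (ℕ; zero; suc; _+_; _*_; _^_; _≤_; _<_; z≤n; s≤s; _≟_; _≤?_)
open import Data.Nat.Properties
  using (≤-reflexive; ≤-trans; <⇒≤; <⇒≢; +-mono-≤; *-monoʳ-≤; *-monoˡ-≤; *-assoc; *-distribʳ-+;
         *-identityʳ; *-commutativeSemigroup; +-cancelˡ-≡; suc-injective; m≢1+n+m; 1+n≢0)
open import Data.Nat.ListAction using (sum)
open import Algebra.Properties.CommutativeSemigroup *-commutativeSemigroup using (x∙yz≈y∙xz; xy∙z≈y∙xz)
open import Data.Bool using (Bool; true; false; _∧_; _∨_; not; T; if_then_else_)
open import Data.Bool.Properties using (T-∧; T-∨)
open import Data.Unit using (tt)
open import Data.Empty using (⊥-elim)
open import Data.Fin using (Fin; toℕ) renaming (zero to fzero; suc to fsuc)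
open import Data.Fin.Properties using (all?; any?) renaming (_≟_ to _≟ᶠ_)
open import Data.Vec using (Vec; []; _∷_; lookup; _[_]≔_)
open import Data.Vec.Properties using (lookup∘update; lookup∘update′; ≡-dec)
open import Data.List using (List; []; _∷_; [_]; _++_; length; map; concatMap; filter; deduplicate; allFin)
open import Data.List.Properties using (length-map; length-++; length-filter; length-deduplicate)
open import Data.List.Membership.Propositional using (_∈_; lose)
open import Data.List.Membership.Propositional.Properties
  using (∈-allFin; ∈-concatMap⁺; ∈-map⁺; ∈-filter⁺; ∈-filter⁻; ∈-deduplicate⁺)
open import Data.List.Relation.Unary.Any using (here)
open import Data.List.Relation.Unary.Unique.Propositional using (Unique)
open import Data.List.Relation.Unary.Unique.Propositional.Properties using (filter⁺)
open import Data.List.Relation.Unary.Unique.DecPropositional.Properties using (deduplicate-!)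
open import Data.Product using (∃; ∃₂; _×_; _,_; proj₁; proj₂)
open import Data.Sum using (_⊎_; inj₁; inj₂; map₂)
open import Function using (_∘_)
open import Function.Bundles using (_⇔_; mk⇔; Equivalence)
open import Relation.Nullary using (¬_; Dec; yes; no; contradiction)
open import Relation.Nullary.Decidable using (_×-dec_; _⊎-dec_; _→-dec_; map′; from-yes; T?)
open import Relation.Binary.PropositionalEquality using (_≡_; _≢_; refl; sym; trans; cong; subst; ≢-sym)

open Equivalence using (from)

-- Counting the words accepted by a finite automaton

length-concatMap-≤ : ∀ {A B : Set} (g : A → List B) (h : A → ℕ) {c d : ℕ} →
                     (∀ x → length (g x) * c ≤ h x * d) →
                     ∀ xs → length (concatMap g xs) * c ≤ sum (map h xs) * d
length-concatMap-≤ g h le [] = z≤n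
length-concatMap-≤ g h {c} {d} le (x ∷ xs) = begin
  length (g x ++ concatMap g xs) * c              ≡⟨ cong (_* c) (length-++ (g x)) ⟩
  (length (g x) + length (concatMap g xs)) * c    ≡⟨ *-distribʳ-+ c (length (g x)) _ ⟩
  length (g x) * c + length (concatMap g xs) * c  ≤⟨ +-mono-≤ (le x) (length-concatMap-≤ g h le xs) ⟩
  h x * d + sum (map h xs) * d                    ≡⟨ *-distribʳ-+ d (h x) _ ⟨
  (h x + sum (map h xs)) * d                      ∎
  where open Data.Nat.Properties.≤-Reasoning

module Automaton {Q X : Set} (letters : List X)
                 (allowed : Q → X → Bool) (next : Q → X → Q) (final : Q → Bool) where

  Accepts : ∀ {n} → Q → Vec X n → Set
  Accepts q []       = T (final q)
  Accepts q (x ∷ xs) = T (allowed q x) × Accepts (next q x) xs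

  words : Q → (n : ℕ) → List (Vec X n)
  words q zero    = if final q then [ [] ] else []
  words q (suc n) = concatMap branch letters
    where
    branch : X → List (Vec X (suc n))
    branch x = if allowed q x then map (x ∷_) (words (next q x) n) else []

  private
    ∈-if : ∀ {A : Set} (b : Bool) {y : A} {ys} → T b → y ∈ ys → y ∈ (if b then ys else [])
    ∈-if true _ y∈ys = y∈ys

  words-complete : (∀ x → x ∈ letters) → ∀ {n} q (xs : Vec X n) → Accepts q xs → xs ∈ words q n
  words-complete _ q [] acc = ∈-if (final q) acc (here refl)
  words-complete all q (x ∷ xs) (ok , acc) =
    ∈-concatMap⁺ _ (lose (all x) (∈-if (allowed q x) ok (∈-map⁺ (x ∷_) (words-complete all _ xs acc))))

  successorWeight : (Q → ℕ) → Q → ℕ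
  successorWeight W q = sum (map (λ x → if allowed q x then W (next q x) else 0) letters)

  length-words-≤ : (W : Q → ℕ) {A B : ℕ} →
                   (∀ q → T (final q) → 1 ≤ W q) →
                   (∀ q → A * successorWeight W q ≤ B * W q) →
                   ∀ q n → length (words q n) * A ^ n ≤ W q * B ^ n
  length-words-≤ W {A} {B} final-pos potential = bound
    where
    base : ∀ (b : Bool) {w} → (T b → 1 ≤ w) → length (if b then [ [] ] else []) * 1 ≤ w * 1
    base true  pos = *-monoˡ-≤ 1 (pos tt)
    base false _   = z≤n

    branch-≤ : ∀ (b : Bool) {m w c d} (x : X) (ys : List (Vec X m)) → length ys * c ≤ w * d →
               length (if b then map (x ∷_) ys else []) * c ≤ (if b then w else 0) * d
    branch-≤ true {c = c} {d} x ys le = subst (λ l → l * c ≤ _) (sym (length-map _ ys)) le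
    branch-≤ false x ys le = z≤n

    bound : ∀ q n → length (words q n) * A ^ n ≤ W q * B ^ n
    bound q zero    = base (final q) (final-pos q)
    bound q (suc n) = begin
      length (words q (suc n)) * (A * A ^ n)    ≡⟨ x∙yz≈y∙xz (length (words q (suc n))) A (A ^ n) ⟩
      A * (length (words q (suc n)) * A ^ n)    ≤⟨ *-monoʳ-≤ A (length-concatMap-≤ _ _ step letters) ⟩
      A * (successorWeight W q * B ^ n)         ≡⟨ *-assoc A _ (B ^ n) ⟨
      A * successorWeight W q * B ^ n           ≤⟨ *-monoˡ-≤ (B ^ n) (potential q) ⟩
      B * W q * B ^ n                           ≡⟨ xy∙z≈y∙xz B (W q) (B ^ n) ⟩
      W q * (B * B ^ n)                         ∎
      where
      open Data.Nat.Properties.≤-Reasoning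
      step : ∀ x → length (if allowed q x then map (x ∷_) (words (next q x) n) else []) * A ^ n
                   ≤ (if allowed q x then W (next q x) else 0) * B ^ n
      step x = branch-≤ (allowed q x) x (words (next q x) n) (bound (next q x) n)

-- Windows of five cells

-- Off marks a position outside the path.
data Sym : Set where
  Zero One Two Off : Sym

symbol : Fin 3 → Sym
symbol fzero                = Zero
symbol (fsuc fzero)         = One
symbol (fsuc (fsuc fzero))  = Two

isTwo : Sym → Bool
isTwo Two = true
isTwo _   = false

isZero : Sym → Bool
isZero Zero = true
isZero _    = false

-- For a Two adjacent to the cell b: b is a Zero whose other neighbour a is not
-- a Two, so that this Two is b's only neighbouring Two.
privateZero : Sym → Sym → Bool
privateZero a b = isZero b ∧ not (isTwo a)

window : Sym → Sym → Sym → Sym → Sym → Bool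
window a b Zero d e = isTwo b ∨ isTwo d
window a b One  d e = not (isTwo b) ∧ not (isTwo d)
window a b Two  d e = privateZero a b ∨ privateZero e d
window a b Off  d e = true

infixr 5 _◂_
_◂_ : Sym → (ℕ → Sym) → ℕ → Sym
(s ◂ S) zero    = s
(s ◂ S) (suc k) = S k

cells : ∀ {n} → Labelling n → ℕ → Sym
cells []       = λ _ → Off
cells (x ∷ xs) = symbol x ◂ cells xs

windowAt : (ℕ → Sym) → ℕ → Bool
windowAt S k = window (S k) (S (1 + k)) (S (2 + k)) (S (3 + k)) (S (4 + k))

data State : Set where
  st : Sym → Sym → Sym → Sym → State

initial : State
initial = st Off Off Off Off

allowed : State → Fin 3 → Bool
allowed (st a b c d) x = window a b c d (symbol x)

next : State → Fin 3 → State
next (st a b c d) x = st b c d (symbol x)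

final : State → Bool
final (st a b c d) = window a b c d Off ∧ window b c d Off Off

open Automaton (allFin 3) allowed next final

-- In cellsFrom initial f, vertex v sits at cell 4 + v; windowAt S k is centred
-- at cell 2 + k.
cellsFrom : ∀ {n} → State → Labelling n → ℕ → Sym
cellsFrom (st a b c d) xs = a ◂ b ◂ c ◂ d ◂ cells xs

accepts-if-windows : ∀ {n} q (xs : Labelling n) → (∀ k → T (windowAt (cellsFrom q xs) k)) → Accepts q xs
accepts-if-windows (st a b c d) []       ok = T-∧ .from (ok 0 , ok 1)
accepts-if-windows (st a b c d) (x ∷ xs) ok = ok 0 , accepts-if-windows (st b c d (symbol x)) xs (ok ∘ suc)

cells-lookup : ∀ {n} (f : Labelling n) v → cells f (toℕ v) ≡ symbol (lookup f v)
cells-lookup (x ∷ f) fzero    = refl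
cells-lookup (x ∷ f) (fsuc v) = cells-lookup f v

cells-Off-or-vertex : ∀ {n} (f : Labelling n) j → cells f j ≡ Off ⊎ ∃ λ (v : Fin n) → toℕ v ≡ j
cells-Off-or-vertex []      j       = inj₁ refl
cells-Off-or-vertex (x ∷ f) zero    = inj₂ (fzero , refl)
cells-Off-or-vertex (x ∷ f) (suc j) = map₂ (λ { (v , p) → fsuc v , cong suc p }) (cells-Off-or-vertex f j)

symbol-Two : ∀ {x} → toℕ x ≡ 2 → symbol x ≡ Two
symbol-Two {fsuc (fsuc fzero)} _ = refl

symbol-Two⁻¹ : ∀ {x} → symbol x ≡ Two → toℕ x ≡ 2
symbol-Two⁻¹ {fsuc (fsuc fzero)} _ = refl

symbol-Zero : ∀ {x} → toℕ x ≡ 0 → symbol x ≡ Zero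
symbol-Zero {fzero} _ = refl

isTwo-≡ : ∀ {s} → s ≡ Two → T (isTwo s)
isTwo-≡ refl = tt

isTwo-≢ : ∀ {s} → s ≢ Two → T (not (isTwo s))
isTwo-≢ {Zero} _     = tt
isTwo-≢ {One}  _     = tt
isTwo-≢ {Two}  s≢Two = s≢Two refl
isTwo-≢ {Off}  _     = tt

privateZero-or-Two : ∀ a b → T (privateZero a b) ⊎ (b ≡ Zero → a ≡ Two)
privateZero-or-Two Two  Zero = inj₂ λ _ → refl
privateZero-or-Two Zero Zero = inj₁ tt
privateZero-or-Two One  Zero = inj₁ tt
privateZero-or-Two Off  Zero = inj₁ tt
privateZero-or-Two a    One  = inj₂ λ ()
privateZero-or-Two a    Two  = inj₂ λ ()
privateZero-or-Two a    Off  = inj₂ λ ()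

-- Lowering a single label

val-update : ∀ {n} (f : Labelling n) v x → val (f [ v ]≔ x) v ≡ toℕ x
val-update f v x = cong toℕ (lookup∘update v f x)

val-update-≢ : ∀ {n} (f : Labelling n) {v w} x → w ≢ v → val (f [ v ]≔ x) w ≡ val f w
val-update-≢ f x w≢v = cong toℕ (lookup∘update′ w≢v f x)

≢-by-val : ∀ {n} (f : Labelling n) {u v p q} → val f u ≡ p → val f v ≡ q → p ≢ q → u ≢ v
≢-by-val f fu fv p≢q refl = p≢q (trans (sym fu) fv)

update-≤L : ∀ {n} (f : Labelling n) v x → toℕ x ≤ val f v → (f [ v ]≔ x) ≤L f
update-≤L f v x le w with w ≟ᶠ v
... | yes refl = subst (_≤ val f v) (sym (val-update f v x)) le
... | no w≢v   = ≤-reflexive (val-update-≢ f x w≢v)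

minimal⇒lowering-not-rdf : ∀ {n} (f : Labelling n) → IsMinimalRDF n f →
                           ∀ v x → toℕ x < val f v → ¬ IsRDF n (f [ v ]≔ x)
minimal⇒lowering-not-rdf f (_ , minimal) v x x<fv g-rdf =
  <⇒≢ x<fv (trans (sym (val-update f v x)) (cong (λ g → val g v) g≡f))
  where
  g≡f : f [ v ]≔ x ≡ f
  g≡f = minimal (f [ v ]≔ x) g-rdf (update-≤L f v x (<⇒≤ x<fv))

lower-to-0-rdf : ∀ {n} (f : Labelling n) {v u} → IsRDF n f → val f v ≡ 1 → PathAdj n v u → val f u ≡ 2 →
                 IsRDF n (f [ v ]≔ fzero)
lower-to-0-rdf {n} f {v} {u} rdf fv≡1 adj fu≡2 = dominated
  where
  kept : ∀ {u} → val f u ≡ 2 → val (f [ v ]≔ fzero) u ≡ 2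
  kept fu≡2 = trans (val-update-≢ f fzero (≢-by-val f fu≡2 fv≡1 λ ())) fu≡2

  dominated : IsRDF n (f [ v ]≔ fzero)
  dominated w gw≡0 with w ≟ᶠ v
  ... | yes refl = u , adj , kept fu≡2
  ... | no w≢v with rdf w (trans (sym (val-update-≢ f fzero w≢v)) gw≡0)
  ...   | u′ , adj′ , fu′≡2 = u′ , adj′ , kept fu′≡2

lower-to-1-rdf : ∀ {n} (f : Labelling n) {v} → IsRDF n f →
                 (∀ {w} → PathAdj n w v → val f w ≡ 0 → ∃ λ u → u ≢ v × PathAdj n w u × val f u ≡ 2) →
                 IsRDF n (f [ v ]≔ fsuc fzero)
lower-to-1-rdf {n} f {v} rdf other = dominated
  where
  kept : ∀ {u} → u ≢ v → val f u ≡ 2 → val (f [ v ]≔ fsuc fzero) u ≡ 2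
  kept u≢v fu≡2 = trans (val-update-≢ f (fsuc fzero) u≢v) fu≡2

  dominated : IsRDF n (f [ v ]≔ fsuc fzero)
  dominated w gw≡0 with w ≟ᶠ v
  ... | yes refl = contradiction (trans (sym (val-update f v (fsuc fzero))) gw≡0) 1+n≢0
  ... | no w≢v with fw≡0 ← trans (sym (val-update-≢ f (fsuc fzero) w≢v)) gw≡0 | rdf w fw≡0
  ...   | u , adj , fu≡2 with u ≟ᶠ v
  ...     | no u≢v = u , adj , kept u≢v fu≡2
  ...     | yes refl with other adj fw≡0
  ...       | u′ , u′≢v , adj′ , fu′≡2 = u′ , adj′ , kept u′≢v fu′≡2

minimal-1⇒no-2-neighbour : ∀ {n} (f : Labelling n) {v u} →
                            IsMinimalRDF n f → val f v ≡ 1 → PathAdj n v u → val f u ≢ 2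
minimal-1⇒no-2-neighbour f {v} m fv≡1 adj fu≡2 =
  minimal⇒lowering-not-rdf f m v fzero (subst (0 <_) (sym fv≡1) (s≤s z≤n))
    (lower-to-0-rdf f (proj₁ m) fv≡1 adj fu≡2)

two-apart-≢ : ∀ {n} {u v : Fin n} → 2 + toℕ u ≡ toℕ v → u ≢ v
two-apart-≢ {u = u} p refl = m≢1+n+m (toℕ u) (sym p)

-- Minimal rdfs satisfy every window

module _ {n : ℕ} (f : Labelling n) where

  private
    S : ℕ → Sym
    S = cellsFrom initial f

  cell-vertex : ∀ v → S (4 + toℕ v) ≡ symbol (lookup f v)
  cell-vertex = cells-lookup f

  cell-two : ∀ {v} → val f v ≡ 2 → S (4 + toℕ v) ≡ Two
  cell-two {v} fv≡2 = trans (cell-vertex v) (symbol-Two fv≡2)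

  cell-zero : ∀ {v} → val f v ≡ 0 → S (4 + toℕ v) ≡ Zero
  cell-zero {v} fv≡0 = trans (cell-vertex v) (symbol-Zero fv≡0)

  two-cell⇒vertex : ∀ k → S k ≡ Two → ∃ λ v → 4 + toℕ v ≡ k × val f v ≡ 2
  two-cell⇒vertex (suc (suc (suc (suc j)))) e with cells-Off-or-vertex f j
  ... | inj₁ off          = contradiction (trans (sym off) e) λ ()
  ... | inj₂ (v , refl)   = v , refl , symbol-Two⁻¹ (trans (sym (cell-vertex v)) e)

  window-at-0 : IsRDF n f → ∀ {v} → val f v ≡ 0 → T (isTwo (S (3 + toℕ v)) ∨ isTwo (S (5 + toℕ v)))
  window-at-0 rdf {v} fv≡0 with rdf v fv≡0
  ... | u , inj₁ v→u , fu≡2 =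
    T-∨ .from (inj₂ (isTwo-≡ (subst (λ i → S (4 + i) ≡ Two) (sym v→u) (cell-two fu≡2))))
  ... | u , inj₂ u→v , fu≡2 =
    T-∨ .from (inj₁ (isTwo-≡ (subst (λ i → S (3 + i) ≡ Two) u→v (cell-two fu≡2))))

  window-at-1 : IsMinimalRDF n f → ∀ {v} → val f v ≡ 1 →
                T (not (isTwo (S (3 + toℕ v))) ∧ not (isTwo (S (5 + toℕ v))))
  window-at-1 m {v} fv≡1 = T-∧ .from (isTwo-≢ left , isTwo-≢ right)
    where
    left : S (3 + toℕ v) ≢ Two
    left e with two-cell⇒vertex (3 + toℕ v) e
    ... | u , q , fu≡2 = minimal-1⇒no-2-neighbour f m fv≡1 (inj₂ (+-cancelˡ-≡ 3 _ _ q)) fu≡2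
    right : S (5 + toℕ v) ≢ Two
    right e with two-cell⇒vertex (5 + toℕ v) e
    ... | u , q , fu≡2 = minimal-1⇒no-2-neighbour f m fv≡1 (inj₁ (sym (+-cancelˡ-≡ 4 _ _ q))) fu≡2

  window-at-2 : IsMinimalRDF n f → ∀ {v} → val f v ≡ 2 →
                T (privateZero (S (2 + toℕ v)) (S (3 + toℕ v)) ∨ privateZero (S (6 + toℕ v)) (S (5 + toℕ v)))
  window-at-2 m {v} fv≡2
    with privateZero-or-Two (S (2 + toℕ v)) (S (3 + toℕ v))
       | privateZero-or-Two (S (6 + toℕ v)) (S (5 + toℕ v))
  ... | inj₁ p    | _        = T-∨ .from (inj₁ p)
  ... | inj₂ _    | inj₁ q   = T-∨ .from (inj₂ q)
  ... | inj₂ left | inj₂ right =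
    ⊥-elim (minimal⇒lowering-not-rdf f m v (fsuc fzero) (subst (1 <_) (sym fv≡2) (s≤s (s≤s z≤n)))
             (lower-to-1-rdf f (proj₁ m) other))
    where
    other : ∀ {w} → PathAdj n w v → val f w ≡ 0 → ∃ λ u → u ≢ v × PathAdj n w u × val f u ≡ 2
    other (inj₁ w→v) fw≡0
      with two-cell⇒vertex (2 + toℕ v) (left (subst (λ i → S (3 + i) ≡ Zero) w→v (cell-zero fw≡0)))
    ... | u , q , fu≡2 = u , two-apart-≢ u→→v , inj₂ (suc-injective (trans u→→v (sym w→v))) , fu≡2
      where
      u→→v : 2 + toℕ u ≡ toℕ v
      u→→v = +-cancelˡ-≡ 2 _ _ q
    other (inj₂ v→w) fw≡0
      with two-cell⇒vertex (6 + toℕ v) (right (subst (λ i → S (4 + i) ≡ Zero) (sym v→w) (cell-zero fw≡0)))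
    ... | u , q , fu≡2 = u , ≢-sym (two-apart-≢ v→→u) , inj₁ (trans (cong suc (sym v→w)) v→→u) , fu≡2
      where
      v→→u : 2 + toℕ v ≡ toℕ u
      v→→u = sym (+-cancelˡ-≡ 4 _ _ q)

  label-window : IsMinimalRDF n f → ∀ v x → lookup f v ≡ x →
                 T (window (S (2 + toℕ v)) (S (3 + toℕ v)) (symbol x) (S (5 + toℕ v)) (S (6 + toℕ v)))
  label-window m v fzero               eq = window-at-0 (proj₁ m) (cong toℕ eq)
  label-window m v (fsuc fzero)        eq = window-at-1 m (cong toℕ eq)
  label-window m v (fsuc (fsuc fzero)) eq = window-at-2 m (cong toℕ eq)

  windows-of-minimal : IsMinimalRDF n f → ∀ k → T (windowAt S k)
  windows-of-minimal m zero          = tt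
  windows-of-minimal m (suc zero)    = tt
  windows-of-minimal m (suc (suc j)) with cells-Off-or-vertex f j
  ... | inj₁ off        = subst (λ c → T (window (S (2 + j)) (S (3 + j)) c (S (5 + j)) (S (6 + j)))) (sym off) tt
  ... | inj₂ (v , refl) =
    subst (λ c → T (window (S (2 + toℕ v)) (S (3 + toℕ v)) c (S (5 + toℕ v)) (S (6 + toℕ v))))
          (sym (cell-vertex v)) (label-window m v (lookup f v) refl)

  minimal-accepted : IsMinimalRDF n f → Accepts initial f
  minimal-accepted m = accepts-if-windows initial f (windows-of-minimal m)

-- The weight certificate

weightByLast : Sym → ℕ
weightByLast Zero = 379734
weightByLast One  = 554233
weightByLast Two  = 328902
weightByLast Off  = 749397

-- An approximate Perron eigenvector of the automaton's transfer matrix, rounded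
-- to integers; states from which no word is accepted get weight 0.
weight : State → ℕ
weight (st _   _    Off  d   ) = weightByLast d
weight (st _   Two  One  _   ) = 0
weight (st _   _    One  Two ) = 0
weight (st _   _    One  d   ) = weightByLast d
weight (st _   Two  Zero d   ) = weightByLast d
weight (st _   _    Zero Two ) = 639891
weight (st _   _    Zero _   ) = 0
weight (st Two Zero Two  Zero) = 554228
weight (st Two Zero Two  _   ) = 0
weight (st _   Zero Two  One ) = 0
weight (st _   Zero Two  Zero) = 749397
weight (st _   Zero Two  d   ) = weightByLast d
weight (st _   _    Two  Zero) = 554228
weight (st _   _    Two  _   ) = 0

all-Sym? : ∀ {P : Sym → Set} → (∀ s → Dec (P s)) → Dec (∀ s → P s)
all-Sym? P? = map′ (λ { (z , o , t , b) → λ { Zero → z ; One → o ; Two → t ; Off → b } })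
                   (λ h → h Zero , h One , h Two , h Off)
                   (P? Zero ×-dec P? One ×-dec P? Two ×-dec P? Off)

all-State? : ∀ {P : State → Set} → (∀ q → Dec (P q)) → Dec (∀ q → P q)
all-State? P? = map′ (λ h → λ { (st a b c d) → h a b c d }) (λ h a b c d → h (st a b c d))
                     (all-Sym? λ a → all-Sym? λ b → all-Sym? λ c → all-Sym? λ d → P? (st a b c d))

weight-final : ∀ q → T (final q) → 1 ≤ weight q
weight-final = from-yes (all-State? λ q → T? (final q) →-dec 1 ≤? weight q)

weight-potential : ∀ q → 10000 * successorWeight weight q ≤ 16852 * weight q
weight-potential = from-yes (all-State? λ q → 10000 * successorWeight weight q ≤? 16852 * weight q)


all-Vec? : ∀ {k n} {P : Vec (Fin k) n → Set} → (∀ xs → Dec (P xs)) → Dec (∀ xs → P xs)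
all-Vec? {n = zero}  P? = map′ (λ p → λ { [] → p }) (λ h → h []) (P? [])
all-Vec? {n = suc n} P? = map′ (λ h → λ { (x ∷ xs) → h x xs }) (λ h x xs → h (x ∷ xs))
                               (all? λ x → all-Vec? λ xs → P? (x ∷ xs))

PathAdj? : ∀ n (i j : Fin n) → Dec (PathAdj n i j)
PathAdj? n i j = (suc (toℕ i) ≟ toℕ j) ⊎-dec (suc (toℕ j) ≟ toℕ i)

IsRDF? : ∀ n (f : Labelling n) → Dec (IsRDF n f)
IsRDF? n f = all? λ v → (val f v ≟ 0) →-dec any? λ u → PathAdj? n v u ×-dec (val f u ≟ 2)

_≤L?_ : ∀ {n} (f g : Labelling n) → Dec (f ≤L g)
f ≤L? g = all? λ v → val f v ≤? val g v

IsMinimalRDF? : ∀ n (f : Labelling n) → Dec (IsMinimalRDF n f)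
IsMinimalRDF? n f = IsRDF? n f ×-dec all-Vec? λ g → IsRDF? n g →-dec (g ≤L? f →-dec ≡-dec _≟ᶠ_ g f)


minimalRDFs : ∀ n → List (Labelling n)
minimalRDFs n = filter (IsMinimalRDF? n) (deduplicate (≡-dec _≟ᶠ_) (words initial n))

minimalRDFs-unique : ∀ n → Unique (minimalRDFs n)
minimalRDFs-unique n = filter⁺ (IsMinimalRDF? n) (deduplicate-! (≡-dec _≟ᶠ_) (words initial n))

∈-minimalRDFs : ∀ {n} (f : Labelling n) → f ∈ minimalRDFs n ⇔ IsMinimalRDF n f
∈-minimalRDFs {n} f = mk⇔ (proj₂ ∘ ∈-filter⁻ (IsMinimalRDF? n) {xs = candidates}) λ m →
  ∈-filter⁺ (IsMinimalRDF? n) (∈-deduplicate⁺ (≡-dec _≟ᶠ_) (words-complete ∈-allFin initial f (minimal-accepted f m))) m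
  where
  candidates : List (Labelling n)
  candidates = deduplicate (≡-dec _≟ᶠ_) (words initial n)

length-minimalRDFs : ∀ n → length (minimalRDFs n) * 10000 ^ n ≤ weight initial * 16852 ^ n
length-minimalRDFs n = ≤-trans (*-monoˡ-≤ (10000 ^ n) filtered-≤)
  (length-words-≤ weight {10000} {16852} weight-final weight-potential initial n)
  where
  filtered-≤ : length (minimalRDFs n) ≤ length (words initial n)
  filtered-≤ = ≤-trans (length-filter (IsMinimalRDF? n) (deduplicate (≡-dec _≟ᶠ_) (words initial n)))
                       (length-deduplicate (≡-dec _≟ᶠ_) (words initial n))

proposition1 : ∃₂ λ (K k : ℕ) → ∀ (n : ℕ) → ∃ λ (L : List (Labelling n)) →
    Unique L × (∀ (f : Labelling n) → (f ∈ L ⇔ IsMinimalRDF n f)) ×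
    length L * 10000 ^ n ≤ K * suc n ^ k * 16852 ^ n
proposition1 = weight initial , 0 , λ n →
  minimalRDFs n , minimalRDFs-unique n , ∈-minimalRDFs ,
  subst (λ K → length (minimalRDFs n) * 10000 ^ n ≤ K * 16852 ^ n)
        (sym (*-identityʳ (weight initial))) (length-minimalRDFs n)
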